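{- Let $\mathsf{V}$ be the subvariety of $V(\mathsf{BCA})$ axiomatised relative to $V(\mathsf{BCA})$ by $J_2\neg x\approx\neg J_2x$. Every $\mathbf{A}\in\mathsf{V}$ embeds into $\mathbf{B}\times\mathbf{C}$ for some $\mathbf{B}\in\mathsf{BA}$ and some $\mathbf{C}\in\mathsf{SL}$.
   Context: $\mathbf{WK}^e$ is the algebra on $\{0,\tfrac12,1\}$ of type $\langle\wedge,\vee,\neg,J_2,0,1\rangle$ with $\neg0=1,\neg\tfrac12=\tfrac12,\neg1=0$; $\vee,\wedge$ Boolean on $\{0,1\}$ and outputting $\tfrac12$ whenever an argument is $\tfrac12$; $J_21=1$, $J_2\tfrac12=J_20=0$. $\mathsf{BCA}=ISP(\mathbf{WK}^e)$ and $V(\mathsf{BCA})$ is the variety it generates. $\mathsf{BA}$ and $\mathsf{SL}$ are the subvarieties of $V(\mathsf{BCA})$ axiomatised relative to $V(\mathsf{BCA})$ by $J_2x\approx x$ and $J_2x\approx1$, respectively. -}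

module Defs where

open import Data.Product using (Σ; ∃; _×_; _,_; proj₁; proj₂)
open import Relation.Binary.PropositionalEquality using (_≡_)
open import Relation.Binary.Structures using (IsEquivalence)

data 𝟛 : Set where
  o h i : 𝟛          -- o = 0, h = ½, i = 1

¬ₖ : 𝟛 → 𝟛
¬ₖ o = i
¬ₖ h = h
¬ₖ i = o

_∧ₖ_ : 𝟛 → 𝟛 → 𝟛
h ∧ₖ _ = h
_ ∧ₖ h = h
o ∧ₖ o = o
o ∧ₖ i = o
i ∧ₖ o = o
i ∧ₖ i = i

_∨ₖ_ : 𝟛 → 𝟛 → 𝟛
h ∨ₖ _ = h
_ ∨ₖ h = h
o ∨ₖ o = o
o ∨ₖ i = i
i ∨ₖ o = i
i ∨ₖ i = i

J₂ₖ : 𝟛 → 𝟛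
J₂ₖ i = i
J₂ₖ h = o
J₂ₖ o = o

-- Algebras of type ⟨∧,∨,¬,J₂,0,1⟩ (carrier with a setoid equality,
-- so that homomorphic images need no quotient types)

record Alg : Set₁ where
  field
    Carrier : Set
    _≈_     : Carrier → Carrier → Set
    isEquiv : IsEquivalence _≈_
    _∧_ _∨_ : Carrier → Carrier → Carrier
    ¬_ J₂   : Carrier → Carrier
    𝟘 𝟙     : Carrier
    ∧-cong  : ∀ {x x′ y y′} → x ≈ x′ → y ≈ y′ → (x ∧ y) ≈ (x′ ∧ y′)
    ∨-cong  : ∀ {x x′ y y′} → x ≈ x′ → y ≈ y′ → (x ∨ y) ≈ (x′ ∨ y′)
    ¬-cong  : ∀ {x x′} → x ≈ x′ → (¬ x) ≈ (¬ x′)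
    J₂-cong : ∀ {x x′} → x ≈ x′ → J₂ x ≈ J₂ x′

open Alg

record Hom (A B : Alg) : Set where
  field
    fun      : Carrier A → Carrier B
    fun-cong : ∀ {x y} → _≈_ A x y → _≈_ B (fun x) (fun y)
    pres-∧   : ∀ x y → _≈_ B (fun (_∧_ A x y)) (_∧_ B (fun x) (fun y))
    pres-∨   : ∀ x y → _≈_ B (fun (_∨_ A x y)) (_∨_ B (fun x) (fun y))
    pres-¬   : ∀ x → _≈_ B (fun (¬_ A x)) (¬_ B (fun x))
    pres-J₂  : ∀ x → _≈_ B (fun (J₂ A x)) (J₂ B (fun x))
    pres-𝟘   : _≈_ B (fun (𝟘 A)) (𝟘 B)
    pres-𝟙   : _≈_ B (fun (𝟙 A)) (𝟙 B)

open Hom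

Surjective : ∀ {A B} → Hom A B → Set
Surjective {A} {B} f = ∀ (b : Carrier B) → ∃ λ a → _≈_ B (fun f a) b

Injective : ∀ {A B} → Hom A B → Set
Injective {A} {B} f = ∀ {x y} → _≈_ B (fun f x) (fun f y) → _≈_ A x y

record SubPower (I : Set) : Set₁ where
  field
    S     : (I → 𝟛) → Set
    cl-∧  : ∀ {f g} → S f → S g → S (λ k → f k ∧ₖ g k)
    cl-∨  : ∀ {f g} → S f → S g → S (λ k → f k ∨ₖ g k)
    cl-¬  : ∀ {f} → S f → S (λ k → ¬ₖ (f k))
    cl-J₂ : ∀ {f} → S f → S (λ k → J₂ₖ (f k))
    cl-𝟘  : S (λ _ → o)
    cl-𝟙  : S (λ _ → i)

module _ {I : Set} (P : SubPower I) where
  open SubPower P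

  SubPowerAlg : Alg
  SubPowerAlg = record
    { Carrier = Σ (I → 𝟛) S
    ; _≈_     = λ f g → ∀ k → proj₁ f k ≡ proj₁ g k
    ; isEquiv = record
        { refl  = λ _ → Eq.refl
        ; sym   = λ p k → Eq.sym (p k)
        ; trans = λ p q k → Eq.trans (p k) (q k) }
    ; _∧_ = λ f g → (λ k → proj₁ f k ∧ₖ proj₁ g k) , cl-∧ (proj₂ f) (proj₂ g)
    ; _∨_ = λ f g → (λ k → proj₁ f k ∨ₖ proj₁ g k) , cl-∨ (proj₂ f) (proj₂ g)
    ; ¬_  = λ f → (λ k → ¬ₖ (proj₁ f k)) , cl-¬ (proj₂ f)
    ; J₂  = λ f → (λ k → J₂ₖ (proj₁ f k)) , cl-J₂ (proj₂ f)
    ; 𝟘   = (λ _ → o) , cl-𝟘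
    ; 𝟙   = (λ _ → i) , cl-𝟙
    ; ∧-cong  = λ p q k → Eq.cong₂ _∧ₖ_ (p k) (q k)
    ; ∨-cong  = λ p q k → Eq.cong₂ _∨ₖ_ (p k) (q k)
    ; ¬-cong  = λ p k → Eq.cong ¬ₖ (p k)
    ; J₂-cong = λ p k → Eq.cong J₂ₖ (p k)
    }
    where import Relation.Binary.PropositionalEquality as Eq

-- V(BCA) = HSP(WK^e): homomorphic images of subalgebras of powers of WK^e

InVBCA : Alg → Set₁
InVBCA A = Σ Set λ I → Σ (SubPower I) λ P →
             Σ (Hom (SubPowerAlg P) A) Surjective

InBA : Alg → Set₁
InBA A = InVBCA A × (∀ x → _≈_ A (J₂ A x) x)

InSL : Alg → Set₁
InSL A = InVBCA A × (∀ x → _≈_ A (J₂ A x) (𝟙 A))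

InV : Alg → Set₁
InV A = InVBCA A × (∀ x → _≈_ A (J₂ A (¬_ A x)) (¬_ A (J₂ A x)))

_⊗_ : Alg → Alg → Alg
B ⊗ C = record
  { Carrier = Carrier B × Carrier C
  ; _≈_ = λ p q → _≈_ B (proj₁ p) (proj₁ q) × _≈_ C (proj₂ p) (proj₂ q)
  ; isEquiv = record
      { refl  = EB.refl , EC.refl
      ; sym   = λ p → EB.sym (proj₁ p) , EC.sym (proj₂ p)
      ; trans = λ p q → EB.trans (proj₁ p) (proj₁ q) , EC.trans (proj₂ p) (proj₂ q) }
  ; _∧_ = λ p q → _∧_ B (proj₁ p) (proj₁ q) , _∧_ C (proj₂ p) (proj₂ q)
  ; _∨_ = λ p q → _∨_ B (proj₁ p) (proj₁ q) , _∨_ C (proj₂ p) (proj₂ q)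
  ; ¬_  = λ p → ¬_ B (proj₁ p) , ¬_ C (proj₂ p)
  ; J₂  = λ p → J₂ B (proj₁ p) , J₂ C (proj₂ p)
  ; 𝟘   = 𝟘 B , 𝟘 C
  ; 𝟙   = 𝟙 B , 𝟙 C
  ; ∧-cong  = λ p q → ∧-cong B (proj₁ p) (proj₁ q) , ∧-cong C (proj₂ p) (proj₂ q)
  ; ∨-cong  = λ p q → ∨-cong B (proj₁ p) (proj₁ q) , ∨-cong C (proj₂ p) (proj₂ q)
  ; ¬-cong  = λ p → ¬-cong B (proj₁ p) , ¬-cong C (proj₂ p)
  ; J₂-cong = λ p → J₂-cong B (proj₁ p) , J₂-cong C (proj₂ p)
  }
  where
    module EB = IsEquivalence (isEquiv B)
    module EC = IsEquivalence (isEquiv C)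

_↪_ : Alg → Alg → Set
A ↪ D = Σ (Hom A D) Injective

{-# OPTIONS --safe #-}
-- A is a subdirect product of its quotients by the kernels of x ↦ J₂ x and
-- x ↦ x ∨ 𝟙.  Identities of WKᵉ are inherited by V(BCA), in particular
-- x ≈ J₂ x ∧ (x ∨ 𝟙), so the two kernels meet in the identity.  The kernel of
-- x ↦ x ∨ 𝟙 is a congruence throughout V(BCA) and its quotient satisfies J₂ x ≈ 𝟙.
-- The kernel of J₂ respects ¬ precisely because J₂ ¬ x ≈ ¬ J₂ x, which together
-- with De Morgan also makes J₂ preserve ∨; its quotient satisfies J₂ x ≈ x.
module Submission where

open import Defs
open import Algebra.Core using (Op₁; Op₂)
open import Algebra.Definitions using (Congruent₁; Congruent₂)
open import Data.Fin using (Fin; zero; suc)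
open import Data.Nat using (ℕ)
open import Data.Product using (Σ; _×_; _,_; proj₁; proj₂)
open import Data.Vec.Functional using (Vector; []; _∷_)
open import Function using (id; _∘_; _on_)
open import Level using (0ℓ)
open import Relation.Binary.Bundles using (Setoid)
open import Relation.Binary.Core using (Rel; _⇒_)
open import Relation.Binary.Structures using (IsEquivalence)
open import Relation.Binary.PropositionalEquality as ≡ using (_≡_; refl)
import Relation.Binary.Construct.On as On
import Relation.Binary.Reasoning.Setoid as SetoidReasoning

open Hom

setoid : Alg → Setoid 0ℓ 0ℓ
setoid A = record { isEquivalence = Alg.isEquiv A }

module Notation (A : Alg) where
  open Alg A public
    renaming (_≈_ to infix 4 _≈_; _∧_ to infixr 7 _∧_; _∨_ to infixr 6 _∨_; ¬_ to infix 8 ¬_)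
  open IsEquivalence isEquiv public
    renaming (refl to ≈-refl; sym to ≈-sym; trans to ≈-trans)
  open SetoidReasoning (setoid A) public

WKᵉ : Alg
WKᵉ = record
  { Carrier = 𝟛 ; _≈_ = _≡_ ; isEquiv = ≡.isEquivalence
  ; _∧_ = _∧ₖ_ ; _∨_ = _∨ₖ_ ; ¬_ = ¬ₖ ; J₂ = J₂ₖ ; 𝟘 = o ; 𝟙 = i
  ; ∧-cong = ≡.cong₂ _∧ₖ_ ; ∨-cong = ≡.cong₂ _∨ₖ_ ; ¬-cong = ≡.cong ¬ₖ ; J₂-cong = ≡.cong J₂ₖ
  }

𝟛-elim : {P : 𝟛 → Set} → P o → P h → P i → ∀ x → P x
𝟛-elim p _ _ o = p
𝟛-elim _ p _ h = p
𝟛-elim _ _ p i = p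

J₂ₖ-∧ₖ : ∀ x y → J₂ₖ (x ∧ₖ y) ≡ J₂ₖ x ∧ₖ J₂ₖ y
J₂ₖ-∧ₖ = 𝟛-elim (𝟛-elim refl refl refl) (𝟛-elim refl refl refl) (𝟛-elim refl refl refl)

∨ₖ-deMorgan : ∀ x y → x ∨ₖ y ≡ ¬ₖ (¬ₖ x ∧ₖ ¬ₖ y)
∨ₖ-deMorgan = 𝟛-elim (𝟛-elim refl refl refl) (𝟛-elim refl refl refl) (𝟛-elim refl refl refl)

J₂ₖ-idem : ∀ x → J₂ₖ (J₂ₖ x) ≡ J₂ₖ x
J₂ₖ-idem = 𝟛-elim refl refl refl

∨ₖi-∧ₖ : ∀ x y → (x ∧ₖ y) ∨ₖ i ≡ (x ∨ₖ i) ∧ₖ (y ∨ₖ i)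
∨ₖi-∧ₖ = 𝟛-elim (𝟛-elim refl refl refl) (𝟛-elim refl refl refl) (𝟛-elim refl refl refl)

∨ₖi-∨ₖ : ∀ x y → (x ∨ₖ y) ∨ₖ i ≡ (x ∨ₖ i) ∨ₖ (y ∨ₖ i)
∨ₖi-∨ₖ = 𝟛-elim (𝟛-elim refl refl refl) (𝟛-elim refl refl refl) (𝟛-elim refl refl refl)

∨ₖi-¬ₖ : ∀ x → ¬ₖ x ∨ₖ i ≡ x ∨ₖ i
∨ₖi-¬ₖ = 𝟛-elim refl refl refl

∨ₖi-J₂ₖ : ∀ x → J₂ₖ x ∨ₖ i ≡ i ∨ₖ i
∨ₖi-J₂ₖ = 𝟛-elim refl refl refl

J₂ₖ-∧ₖ-∨ₖi : ∀ x → x ≡ J₂ₖ x ∧ₖ (x ∨ₖ i)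
J₂ₖ-∧ₖ-∨ₖi = 𝟛-elim refl refl refl

infixr 7 _∧ᵗ_
infixr 6 _∨ᵗ_
infix 8 ¬ᵗ_

data Term (n : ℕ) : Set where
  var       : Fin n → Term n
  _∧ᵗ_ _∨ᵗ_ : Term n → Term n → Term n
  ¬ᵗ_ J₂ᵗ   : Term n → Term n
  𝟘ᵗ 𝟙ᵗ     : Term n

x̂ ŷ : Term 2
x̂ = var zero
ŷ = var (suc zero)

module _ (A : Alg) where
  open Notation A

  eval : ∀ {n} → Term n → Vector Carrier n → Carrier
  eval (var j)  ρ = ρ j
  eval (s ∧ᵗ t) ρ = eval s ρ ∧ eval t ρ
  eval (s ∨ᵗ t) ρ = eval s ρ ∨ eval t ρ
  eval (¬ᵗ t)   ρ = ¬ eval t ρ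
  eval (J₂ᵗ t)  ρ = J₂ (eval t ρ)
  eval 𝟘ᵗ       ρ = 𝟘
  eval 𝟙ᵗ       ρ = 𝟙

  eval-cong : ∀ {n} (t : Term n) {ρ σ : Vector Carrier n} →
              (∀ j → ρ j ≈ σ j) → eval t ρ ≈ eval t σ
  eval-cong (var j)  ρ≈σ = ρ≈σ j
  eval-cong (s ∧ᵗ t) ρ≈σ = ∧-cong (eval-cong s ρ≈σ) (eval-cong t ρ≈σ)
  eval-cong (s ∨ᵗ t) ρ≈σ = ∨-cong (eval-cong s ρ≈σ) (eval-cong t ρ≈σ)
  eval-cong (¬ᵗ t)   ρ≈σ = ¬-cong (eval-cong t ρ≈σ)
  eval-cong (J₂ᵗ t)  ρ≈σ = J₂-cong (eval-cong t ρ≈σ)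
  eval-cong 𝟘ᵗ       ρ≈σ = ≈-refl
  eval-cong 𝟙ᵗ       ρ≈σ = ≈-refl

_⊧_≈ᵗ_ : ∀ {n} → Alg → Term n → Term n → Set
A ⊧ s ≈ᵗ t = ∀ ρ → Alg._≈_ A (eval A s ρ) (eval A t ρ)

module _ {A B : Alg} (φ : Hom A B) where
  open Notation B

  eval-hom : ∀ {n} (t : Term n) (ρ : Vector (Alg.Carrier A) n) →
             fun φ (eval A t ρ) ≈ eval B t (fun φ ∘ ρ)
  eval-hom (var j)  ρ = ≈-refl
  eval-hom (s ∧ᵗ t) ρ = ≈-trans (pres-∧ φ _ _) (∧-cong (eval-hom s ρ) (eval-hom t ρ))
  eval-hom (s ∨ᵗ t) ρ = ≈-trans (pres-∨ φ _ _) (∨-cong (eval-hom s ρ) (eval-hom t ρ))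
  eval-hom (¬ᵗ t)   ρ = ≈-trans (pres-¬ φ _) (¬-cong (eval-hom t ρ))
  eval-hom (J₂ᵗ t)  ρ = ≈-trans (pres-J₂ φ _) (J₂-cong (eval-hom t ρ))
  eval-hom 𝟘ᵗ       ρ = pres-𝟘 φ
  eval-hom 𝟙ᵗ       ρ = pres-𝟙 φ

  ⊧-image : Surjective φ → ∀ {n} (s t : Term n) → A ⊧ s ≈ᵗ t → B ⊧ s ≈ᵗ t
  ⊧-image φ-surj s t s≈t ρ = begin
    eval B s ρ             ≈⟨ eval-cong B s (≈-sym ∘ φρ′≈ρ) ⟩
    eval B s (fun φ ∘ ρ′)  ≈⟨ eval-hom s ρ′ ⟨
    fun φ (eval A s ρ′)    ≈⟨ fun-cong φ (s≈t ρ′) ⟩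
    fun φ (eval A t ρ′)    ≈⟨ eval-hom t ρ′ ⟩
    eval B t (fun φ ∘ ρ′)  ≈⟨ eval-cong B t φρ′≈ρ ⟩
    eval B t ρ             ∎
    where
      ρ′ = proj₁ ∘ φ-surj ∘ ρ
      φρ′≈ρ = proj₂ ∘ φ-surj ∘ ρ

eval-pointwise : ∀ {I n} (P : SubPower I) (t : Term n) ρ (k : I) →
                 proj₁ (eval (SubPowerAlg P) t ρ) k ≡ eval WKᵉ t (λ j → proj₁ (ρ j) k)
eval-pointwise P (var j)  ρ k = refl
eval-pointwise P (s ∧ᵗ t) ρ k = ≡.cong₂ _∧ₖ_ (eval-pointwise P s ρ k) (eval-pointwise P t ρ k)
eval-pointwise P (s ∨ᵗ t) ρ k = ≡.cong₂ _∨ₖ_ (eval-pointwise P s ρ k) (eval-pointwise P t ρ k)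
eval-pointwise P (¬ᵗ t)   ρ k = ≡.cong ¬ₖ (eval-pointwise P t ρ k)
eval-pointwise P (J₂ᵗ t)  ρ k = ≡.cong J₂ₖ (eval-pointwise P t ρ k)
eval-pointwise P 𝟘ᵗ       ρ k = refl
eval-pointwise P 𝟙ᵗ       ρ k = refl

⊧-subpower : ∀ {I n} (P : SubPower I) (s t : Term n) →
             WKᵉ ⊧ s ≈ᵗ t → SubPowerAlg P ⊧ s ≈ᵗ t
⊧-subpower P s t s≈t ρ k = begin
  proj₁ (eval (SubPowerAlg P) s ρ) k   ≡⟨ eval-pointwise P s ρ k ⟩
  eval WKᵉ s (λ j → proj₁ (ρ j) k)     ≡⟨ s≈t _ ⟩
  eval WKᵉ t (λ j → proj₁ (ρ j) k)     ≡⟨ eval-pointwise P t ρ k ⟨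
  proj₁ (eval (SubPowerAlg P) t ρ) k   ∎
  where open ≡.≡-Reasoning

⊧-VBCA : ∀ {A n} → InVBCA A → (s t : Term n) → WKᵉ ⊧ s ≈ᵗ t → A ⊧ s ≈ᵗ t
⊧-VBCA (_ , P , φ , φ-surj) s t s≈t = ⊧-image φ φ-surj s t (⊧-subpower P s t s≈t)

_∘ʰ_ : ∀ {A B C} → Hom B C → Hom A B → Hom A C
_∘ʰ_ {C = C} ψ φ = record
  { fun      = fun ψ ∘ fun φ
  ; fun-cong = fun-cong ψ ∘ fun-cong φ
  ; pres-∧   = λ x y → ≈-trans (fun-cong ψ (pres-∧ φ x y)) (pres-∧ ψ _ _)
  ; pres-∨   = λ x y → ≈-trans (fun-cong ψ (pres-∨ φ x y)) (pres-∨ ψ _ _)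
  ; pres-¬   = λ x → ≈-trans (fun-cong ψ (pres-¬ φ x)) (pres-¬ ψ _)
  ; pres-J₂  = λ x → ≈-trans (fun-cong ψ (pres-J₂ φ x)) (pres-J₂ ψ _)
  ; pres-𝟘   = ≈-trans (fun-cong ψ (pres-𝟘 φ)) (pres-𝟘 ψ)
  ; pres-𝟙   = ≈-trans (fun-cong ψ (pres-𝟙 φ)) (pres-𝟙 ψ)
  }
  where open Notation C

∘ʰ-surjective : ∀ {A B C} (ψ : Hom B C) (φ : Hom A B) →
                Surjective ψ → Surjective φ → Surjective (ψ ∘ʰ φ)
∘ʰ-surjective {C = C} ψ φ ψ-surj φ-surj c =
  let (b , ψb≈c) = ψ-surj c ; (a , φa≈b) = φ-surj b
  in a , Notation.≈-trans C (fun-cong ψ φa≈b) ψb≈c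

⟨_,_⟩ʰ : ∀ {A B C} → Hom A B → Hom A C → Hom A (B ⊗ C)
⟨ φ , ψ ⟩ʰ = record
  { fun      = λ x → fun φ x , fun ψ x
  ; fun-cong = λ x≈y → fun-cong φ x≈y , fun-cong ψ x≈y
  ; pres-∧   = λ x y → pres-∧ φ x y , pres-∧ ψ x y
  ; pres-∨   = λ x y → pres-∨ φ x y , pres-∨ ψ x y
  ; pres-¬   = λ x → pres-¬ φ x , pres-¬ ψ x
  ; pres-J₂  = λ x → pres-J₂ φ x , pres-J₂ ψ x
  ; pres-𝟘   = pres-𝟘 φ , pres-𝟘 ψ
  ; pres-𝟙   = pres-𝟙 φ , pres-𝟙 ψ
  }

InVBCA-image : ∀ {A B} → InVBCA A → (φ : Hom A B) → Surjective φ → InVBCA B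
InVBCA-image (I , P , ψ , ψ-surj) φ φ-surj = I , P , φ ∘ʰ ψ , ∘ʰ-surjective φ ψ φ-surj ψ-surj

record Congruence (A : Alg) : Set₁ where
  open Notation A
  field
    _∼_           : Rel Carrier 0ℓ
    isEquivalence : IsEquivalence _∼_
    ≈⇒∼           : _≈_ ⇒ _∼_
    ∧-compat      : Congruent₂ _∼_ _∧_
    ∨-compat      : Congruent₂ _∼_ _∨_
    ¬-compat      : Congruent₁ _∼_ ¬_
    J₂-compat     : Congruent₁ _∼_ J₂

open Congruence

infix 21 _/_

_/_ : (A : Alg) → Congruence A → Alg
A / θ = record
  { Carrier = Carrier ; _≈_ = _∼_ θ ; isEquiv = isEquivalence θ
  ; _∧_ = _∧_ ; _∨_ = _∨_ ; ¬_ = ¬_ ; J₂ = J₂ ; 𝟘 = 𝟘 ; 𝟙 = 𝟙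
  ; ∧-cong = ∧-compat θ ; ∨-cong = ∨-compat θ ; ¬-cong = ¬-compat θ ; J₂-cong = J₂-compat θ
  }
  where open Notation A

module _ {A : Alg} (θ : Congruence A) where
  open Notation (A / θ) using (≈-refl)

  quotient : Hom A (A / θ)
  quotient = record
    { fun = λ x → x ; fun-cong = ≈⇒∼ θ
    ; pres-∧ = λ _ _ → ≈-refl ; pres-∨ = λ _ _ → ≈-refl ; pres-¬ = λ _ → ≈-refl
    ; pres-J₂ = λ _ → ≈-refl ; pres-𝟘 = ≈-refl ; pres-𝟙 = ≈-refl
    }

  quotient-surjective : Surjective quotient
  quotient-surjective x = x , ≈-refl

InVBCA-/ : ∀ {A} → InVBCA A → (θ : Congruence A) → InVBCA (A / θ)
InVBCA-/ A∈VBCA θ = InVBCA-image A∈VBCA (quotient θ) (quotient-surjective θ)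

↪-subdirect : ∀ {A} (θ₁ θ₂ : Congruence A) →
              (∀ {x y} → _∼_ θ₁ x y → _∼_ θ₂ x y → Alg._≈_ A x y) → A ↪ (A / θ₁ ⊗ A / θ₂)
↪-subdirect θ₁ θ₂ separate = ⟨ quotient θ₁ , quotient θ₂ ⟩ʰ , λ (x∼₁y , x∼₂y) → separate x∼₁y x∼₂y

module Kernel (A : Alg) where
  open Notation A

  kernel : (φ : Carrier → Carrier) → Congruent₁ _≈_ φ →
           Congruent₂ (_≈_ on φ) _∧_ → Congruent₂ (_≈_ on φ) _∨_ →
           Congruent₁ (_≈_ on φ) ¬_ → Congruent₁ (_≈_ on φ) J₂ → Congruence A
  kernel φ φ-cong ∧-compat ∨-compat ¬-compat J₂-compat = record
    { _∼_ = _≈_ on φ ; isEquivalence = On.isEquivalence φ isEquiv ; ≈⇒∼ = φ-cong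
    ; ∧-compat = ∧-compat ; ∨-compat = ∨-compat ; ¬-compat = ¬-compat ; J₂-compat = J₂-compat
    }

  module _ (φ : Carrier → Carrier) where

    hom⇒kernel-compat₂ : {_∙_ _∙′_ : Op₂ Carrier} → Congruent₂ _≈_ _∙′_ →
                         (∀ x y → φ (x ∙ y) ≈ φ x ∙′ φ y) → Congruent₂ (_≈_ on φ) _∙_
    hom⇒kernel-compat₂ {_∙_} {_∙′_} ∙′-cong φ-hom {x} {x′} {y} {y′} φx≈φx′ φy≈φy′ = begin
      φ (x ∙ y)     ≈⟨ φ-hom x y ⟩
      φ x ∙′ φ y    ≈⟨ ∙′-cong φx≈φx′ φy≈φy′ ⟩
      φ x′ ∙′ φ y′  ≈⟨ φ-hom x′ y′ ⟨
      φ (x′ ∙ y′)   ∎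

    hom⇒kernel-compat₁ : {f g : Op₁ Carrier} → Congruent₁ _≈_ g →
                         (∀ x → φ (f x) ≈ g (φ x)) → Congruent₁ (_≈_ on φ) f
    hom⇒kernel-compat₁ {f} {g} g-cong φ-hom {x} {x′} φx≈φx′ = begin
      φ (f x)   ≈⟨ φ-hom x ⟩
      g (φ x)   ≈⟨ g-cong φx≈φx′ ⟩
      g (φ x′)  ≈⟨ φ-hom x′ ⟨
      φ (f x′)  ∎

vector₂-η : ∀ {a} {X : Set a} (ρ : Vector X 2) (j : Fin 2) →
            ρ j ≡ (ρ zero ∷ ρ (suc zero) ∷ []) j
vector₂-η ρ zero       = refl
vector₂-η ρ (suc zero) = refl

module VBCA-Properties {A : Alg} (A∈VBCA : InVBCA A) where
  open Notation A
  open Kernel A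

  inherit : (s t : Term 2) → (∀ x y → eval WKᵉ s (x ∷ y ∷ []) ≡ eval WKᵉ t (x ∷ y ∷ [])) →
            ∀ x y → eval A s (x ∷ y ∷ []) ≈ eval A t (x ∷ y ∷ [])
  inherit s t s≈t x y = ⊧-VBCA A∈VBCA s t s≈ᵗt (x ∷ y ∷ [])
    where
      s≈ᵗt : WKᵉ ⊧ s ≈ᵗ t
      s≈ᵗt ρ = ≡.trans (eval-cong WKᵉ s (vector₂-η ρ))
                 (≡.trans (s≈t _ _) (≡.sym (eval-cong WKᵉ t (vector₂-η ρ))))

  J₂-∧ : ∀ x y → J₂ (x ∧ y) ≈ J₂ x ∧ J₂ y
  J₂-∧ = inherit (J₂ᵗ (x̂ ∧ᵗ ŷ)) (J₂ᵗ x̂ ∧ᵗ J₂ᵗ ŷ) J₂ₖ-∧ₖ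

  ∨-deMorgan : ∀ x y → x ∨ y ≈ ¬ (¬ x ∧ ¬ y)
  ∨-deMorgan = inherit (x̂ ∨ᵗ ŷ) (¬ᵗ (¬ᵗ x̂ ∧ᵗ ¬ᵗ ŷ)) ∨ₖ-deMorgan

  J₂-idem : ∀ x → J₂ (J₂ x) ≈ J₂ x
  J₂-idem x = inherit (J₂ᵗ (J₂ᵗ x̂)) (J₂ᵗ x̂) (λ x _ → J₂ₖ-idem x) x x

  ∨𝟙-∧ : ∀ x y → (x ∧ y) ∨ 𝟙 ≈ (x ∨ 𝟙) ∧ (y ∨ 𝟙)
  ∨𝟙-∧ = inherit ((x̂ ∧ᵗ ŷ) ∨ᵗ 𝟙ᵗ) ((x̂ ∨ᵗ 𝟙ᵗ) ∧ᵗ (ŷ ∨ᵗ 𝟙ᵗ)) ∨ₖi-∧ₖ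

  ∨𝟙-∨ : ∀ x y → (x ∨ y) ∨ 𝟙 ≈ (x ∨ 𝟙) ∨ (y ∨ 𝟙)
  ∨𝟙-∨ = inherit ((x̂ ∨ᵗ ŷ) ∨ᵗ 𝟙ᵗ) ((x̂ ∨ᵗ 𝟙ᵗ) ∨ᵗ (ŷ ∨ᵗ 𝟙ᵗ)) ∨ₖi-∨ₖ

  ∨𝟙-¬ : ∀ x → ¬ x ∨ 𝟙 ≈ x ∨ 𝟙
  ∨𝟙-¬ x = inherit (¬ᵗ x̂ ∨ᵗ 𝟙ᵗ) (x̂ ∨ᵗ 𝟙ᵗ) (λ x _ → ∨ₖi-¬ₖ x) x x

  ∨𝟙-J₂ : ∀ x → J₂ x ∨ 𝟙 ≈ 𝟙 ∨ 𝟙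
  ∨𝟙-J₂ x = inherit (J₂ᵗ x̂ ∨ᵗ 𝟙ᵗ) (𝟙ᵗ ∨ᵗ 𝟙ᵗ) (λ x _ → ∨ₖi-J₂ₖ x) x x

  J₂-∧-∨𝟙 : ∀ x → x ≈ J₂ x ∧ (x ∨ 𝟙)
  J₂-∧-∨𝟙 x = inherit x̂ (J₂ᵗ x̂ ∧ᵗ (x̂ ∨ᵗ 𝟙ᵗ)) (λ x _ → J₂ₖ-∧ₖ-∨ₖi x) x x

  ∨𝟙-kernel : Congruence A
  ∨𝟙-kernel = kernel (_∨ 𝟙) (λ x≈y → ∨-cong x≈y ≈-refl)
    (hom⇒kernel-compat₂ (_∨ 𝟙) ∧-cong ∨𝟙-∧) (hom⇒kernel-compat₂ (_∨ 𝟙) ∨-cong ∨𝟙-∨)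
    (hom⇒kernel-compat₁ (_∨ 𝟙) id ∨𝟙-¬)
    (hom⇒kernel-compat₁ (_∨ 𝟙) {g = λ _ → 𝟙 ∨ 𝟙} (λ _ → ≈-refl) ∨𝟙-J₂)

  A/∨𝟙-kernel∈SL : InSL (A / ∨𝟙-kernel)
  A/∨𝟙-kernel∈SL = InVBCA-/ A∈VBCA ∨𝟙-kernel , ∨𝟙-J₂

  J₂-∨𝟙-injective : ∀ {x y} → J₂ x ≈ J₂ y → x ∨ 𝟙 ≈ y ∨ 𝟙 → x ≈ y
  J₂-∨𝟙-injective {x} {y} J₂x≈J₂y x∨𝟙≈y∨𝟙 = begin
    x               ≈⟨ J₂-∧-∨𝟙 x ⟩
    J₂ x ∧ (x ∨ 𝟙)  ≈⟨ ∧-cong J₂x≈J₂y x∨𝟙≈y∨𝟙 ⟩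
    J₂ y ∧ (y ∨ 𝟙)  ≈⟨ J₂-∧-∨𝟙 y ⟨
    y               ∎

module V-Properties {A : Alg} (A∈V : InV A) where
  open Notation A
  open Kernel A
  open VBCA-Properties (proj₁ A∈V)

  J₂-¬ : ∀ x → J₂ (¬ x) ≈ ¬ J₂ x
  J₂-¬ = proj₂ A∈V

  J₂-∨ : ∀ x y → J₂ (x ∨ y) ≈ J₂ x ∨ J₂ y
  J₂-∨ x y = begin
    J₂ (x ∨ y)                ≈⟨ J₂-cong (∨-deMorgan x y) ⟩
    J₂ (¬ (¬ x ∧ ¬ y))        ≈⟨ J₂-¬ (¬ x ∧ ¬ y) ⟩
    ¬ J₂ (¬ x ∧ ¬ y)          ≈⟨ ¬-cong (J₂-∧ (¬ x) (¬ y)) ⟩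
    ¬ (J₂ (¬ x) ∧ J₂ (¬ y))   ≈⟨ ¬-cong (∧-cong (J₂-¬ x) (J₂-¬ y)) ⟩
    ¬ (¬ J₂ x ∧ ¬ J₂ y)       ≈⟨ ∨-deMorgan (J₂ x) (J₂ y) ⟨
    J₂ x ∨ J₂ y               ∎

  J₂-kernel : Congruence A
  J₂-kernel = kernel J₂ J₂-cong
    (hom⇒kernel-compat₂ J₂ ∧-cong J₂-∧) (hom⇒kernel-compat₂ J₂ ∨-cong J₂-∨)
    (hom⇒kernel-compat₁ J₂ ¬-cong J₂-¬) J₂-cong

  A/J₂-kernel∈BA : InBA (A / J₂-kernel)
  A/J₂-kernel∈BA = InVBCA-/ (proj₁ A∈V) J₂-kernel , J₂-idem

theorem4p13 : (A : Alg) → InV A →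
    Σ Alg λ B → Σ Alg λ C → InBA B × InSL C × (A ↪ (B ⊗ C))
theorem4p13 A A∈V =
  A / J₂-kernel , A / ∨𝟙-kernel , A/J₂-kernel∈BA , A/∨𝟙-kernel∈SL ,
  ↪-subdirect J₂-kernel ∨𝟙-kernel J₂-∨𝟙-injective
  where
    open VBCA-Properties (proj₁ A∈V)
    open V-Properties A∈V
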